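{- Let $V$ be a finite set and $\mathcal{P}$, $\mathcal{P}'$ partitions of $V$, with $\vert\mathcal{P}\vert\ge 2$. Let $(\mathcal{S}, \mathcal{S}')$ be an optimal $C_{\mathcal{P}}$-correspondence. If $(\mathcal{S}, \mathcal{S}')$ is not mutual, then $\vert \mathcal{S} \vert \in \{1, \vert \mathcal{P} \vert - 1\}$ or $\vert \mathcal{S}' \vert \in \{1, \vert \mathcal{P}' \vert - 1\}$.
   Context: $U_{\mathcal{S}}$ denotes the union of the members of $\mathcal{S}$; $\triangle$ is symmetric difference; $\vert\cdot\vert$ applied to subsets of $V$ is cardinality (or total weight, if elements carry positive weights), and applied to $\mathcal{S}$, $\mathcal{S}'$ is the number of parts. A correspondence is a pair $(\mathcal{S},\mathcal{S}')$ with $\mathcal{S}\subseteq\mathcal{P}$, $\mathcal{S}'\subseteq\mathcal{P}'$; a $C_{\mathcal{P}}$-correspondence is one with $\mathcal{S}\notin\{\emptyset,\mathcal{P}\}$, and it is optimal if it minimizes $\vert U_{\mathcal{S}} \triangle U_{\mathcal{S}'}\vert$ among all $C_{\mathcal{P}}$-correspondences. A correspondence $(\mathcal{S},\mathcal{S}')$ is mutual if (1) $\vert P \cap U_{\mathcal{S}'}\vert \ge \vert P\vert/2$ for all $P\in\mathcal{S}$; (2) $\vert P \cap U_{\mathcal{S}'}\vert \le \vert P\vert/2$ for all $P\in\mathcal{P}\setminus\mathcal{S}$; (3) $\vert P' \cap U_{\mathcal{S}}\vert \ge \vert P'\vert/2$ for all $P'\in\mathcal{S}'$; (4) $\vert P'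 \cap U_{\mathcal{S}}\vert \le \vert P'\vert/2$ for all $P'\in\mathcal{P}'\setminus\mathcal{S}'$. -}

module Defs where

open import Data.Nat using (ℕ; _*_; _≤_)
open import Data.Fin using (Fin; _≟_)
open import Data.Fin.Subset using (Subset; ∣_∣; _∩_; _∈_; _∉_; ⊥; ⊤)
open import Data.Vec using (tabulate; lookup; zipWith)
open import Data.Bool using (_xor_)
open import Data.Product using (_×_)
open import Function.Definitions using (Surjective)
open import Relation.Binary.PropositionalEquality using (_≡_; _≢_)
open import Relation.Nullary.Decidable using (⌊_⌋)

-- A partition of V into k parts is encoded by
-- a surjective labelling  f : Fin n → Fin k ; the parts are the fibres
-- P_i = f⁻¹(i), which are nonempty by surjectivity.  |𝒫| = k.
IsPartition : ∀ {n k} → (Fin n → Fin k) → Set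
IsPartition f = Surjective _≡_ _≡_ f

part : ∀ {n k} → (Fin n → Fin k) → Fin k → Subset n
part f i = tabulate (λ v → ⌊ f v ≟ i ⌋)

-- U_𝒮 : union of the parts selected by 𝒮 ⊆ 𝒫 (𝒮 a subset of the labels)
U : ∀ {n k} → (Fin n → Fin k) → Subset k → Subset n
U f S = tabulate (λ v → lookup S (f v))

_△_ : ∀ {n} → Subset n → Subset n → Subset n
A △ B = zipWith _xor_ A B

cost : ∀ {n k k'} → (Fin n → Fin k) → (Fin n → Fin k') →
       Subset k → Subset k' → ℕ
cost f g S S' = ∣ U f S △ U g S' ∣

IsCP : ∀ {k} → Subset k → Set
IsCP S = S ≢ ⊥ × S ≢ ⊤

Optimal : ∀ {n k k'} → (Fin n → Fin k) → (Fin n → Fin k') →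
          Subset k → Subset k' → Set
Optimal {k = k} {k'} f g S S' =
  IsCP S ×
  (∀ (T : Subset k) (T' : Subset k') → IsCP T → cost f g S S' ≤ cost f g T T')

-- mutual correspondence (|X| ≥ |P|/2 written as |P| ≤ 2|X|)
Mutual : ∀ {n k k'} → (Fin n → Fin k) → (Fin n → Fin k') →
         Subset k → Subset k' → Set
Mutual {k = k} {k'} f g S S' =
  (∀ (i : Fin k) → i ∈ S → ∣ part f i ∣ ≤ 2 * ∣ part f i ∩ U g S' ∣) ×
  (∀ (i : Fin k) → i ∉ S → 2 * ∣ part f i ∩ U g S' ∣ ≤ ∣ part f i ∣) ×
  (∀ (j : Fin k') → j ∈ S' → ∣ part g j ∣ ≤ 2 * ∣ part g j ∩ U f S ∣) ×
  (∀ (j : Fin k') → j ∉ S' → 2 * ∣ part g j ∩ U f S ∣ ≤ ∣ part g j ∣)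

module Submission where

-- Say that 𝒮 is balanced against 𝒮' when every part P ∈ 𝒮 has at
-- least half of its elements in U_𝒮' and every part P ∉ 𝒮 at most half; a
-- correspondence (𝒮, 𝒮') is mutual iff 𝒮 is balanced against 𝒮' and 𝒮' against 𝒮.
-- Toggling the membership of a single part P_i in 𝒮 changes the cost by exactly
-- (#elements of P_i disagreeing with U_𝒮') − (#elements agreeing with it): this is
-- the exchange identity below.  Hence, if no single toggle lowers the cost, 𝒮 is
-- balanced against 𝒮'.  For an optimal C_𝒫-correspondence every toggle of a part
-- of 𝒮' is an admissible competitor (admissibility only constrains 𝒮), and so is
-- every toggle of a part of 𝒮 once |𝒮| ∉ {1, |𝒫| − 1}, because a toggle changes
-- |𝒮| by exactly one.  Thus |𝒮| ∉ {1, |𝒫| − 1} forces mutuality, which is the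
-- contrapositive of the proposition (already with its first alternative alone).

open import Defs
open import Data.Nat using (ℕ; suc; _≤_; _+_; _*_) renaming (_≟_ to _≟ℕ_)
open import Data.Nat.Properties
  using (+-comm; +-identityʳ; +-cancelˡ-≤; +-monoˡ-≤; +-monoʳ-≤; module ≤-Reasoning; ≤-reflexive; ≤-trans; m+1+n≰m; 0≢1+n; +-commutativeSemigroup)
open import Algebra.Properties.CommutativeSemigroup +-commutativeSemigroup using (interchange)
open import Data.Fin using (Fin; _≟_) renaming (zero to fzero; suc to fsuc)
open import Data.Fin.Subset using (Subset; ∣_∣; _∩_; _∈_; _∉_; ⊥; ⊤)
open import Data.Fin.Subset.Properties using (∣⊥∣≡0; ∣⊤∣≡n; ∣p∣≤n)
open import Data.Vec using (tabulate; lookup; zipWith; _∷_)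
open import Data.Vec.Properties using (lookup∘tabulate; tabulate∘lookup; tabulate-cong; []=⇒lookup; lookup⇒[]=)
open import Data.Bool using (Bool; true; false; not; _∧_; _xor_)
open import Data.Bool.Properties using (xor-comm; not-involutive; ¬-not)
open import Data.Product using (_×_; _,_)
open import Data.Sum using (_⊎_; inj₁; inj₂)
open import Function using (_∘_)
open import Relation.Binary.PropositionalEquality
  using (_≡_; _≢_; refl; sym; trans; cong; cong₂; subst₂; module ≡-Reasoning)
open import Relation.Nullary using (¬_; yes; no; contradiction)
open import Relation.Nullary.Decidable using (⌊_⌋)

ind : Bool → ℕ
ind true  = 1
ind false = 0

count : ∀ {n} → (Fin n → Bool) → ℕ
count h = ∣ tabulate h ∣

count-suc : ∀ {n} (h : Fin (suc n) → Bool) → count h ≡ ind (h fzero) + count (h ∘ fsuc)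
count-suc h with h fzero
... | true  = refl
... | false = refl

count-cong : ∀ {n} {a b : Fin n → Bool} → (∀ v → a v ≡ b v) → count a ≡ count b
count-cong a≗b = cong ∣_∣ (tabulate-cong a≗b)

count-false : ∀ {n} → count {n} (λ _ → false) ≡ 0
count-false {0}     = refl
count-false {suc n} = count-false {n}

count-additive : ∀ {n} (a b c d : Fin n → Bool) →
  (∀ v → ind (a v) + ind (b v) ≡ ind (c v) + ind (d v)) →
  count a + count b ≡ count c + count d
count-additive {0}     a b c d pointwise = refl
count-additive {suc n} a b c d pointwise = begin
  count a + count b
    ≡⟨ cong₂ _+_ (count-suc a) (count-suc b) ⟩
  (ind (a fzero) + count (a ∘ fsuc)) + (ind (b fzero) + count (b ∘ fsuc))
    ≡⟨ interchange (ind (a fzero)) _ _ _ ⟩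
  (ind (a fzero) + ind (b fzero)) + (count (a ∘ fsuc) + count (b ∘ fsuc))
    ≡⟨ cong₂ _+_ (pointwise fzero) (count-additive _ _ _ _ (pointwise ∘ fsuc)) ⟩
  (ind (c fzero) + ind (d fzero)) + (count (c ∘ fsuc) + count (d ∘ fsuc))
    ≡⟨ interchange (ind (c fzero)) _ _ _ ⟩
  (ind (c fzero) + count (c ∘ fsuc)) + (ind (d fzero) + count (d ∘ fsuc))
    ≡⟨ sym (cong₂ _+_ (count-suc c) (count-suc d)) ⟩
  count c + count d ∎
  where open ≡-Reasoning

count-split : ∀ {n} (d τ : Fin n → Bool) →
  count d ≡ count (λ v → d v ∧ not (τ v)) + count (λ v → d v ∧ τ v)
count-split {n} d τ = begin
  count d                         ≡⟨ sym (+-identityʳ _) ⟩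
  count d + 0                     ≡⟨ cong (count d +_) (sym (count-false {n})) ⟩
  count d + count {n} (λ _ → false)
    ≡⟨ count-additive d (λ _ → false) _ _ (λ v → split (d v) (τ v)) ⟩
  count (λ v → d v ∧ not (τ v)) + count (λ v → d v ∧ τ v) ∎
  where
  open ≡-Reasoning
  split : ∀ x t → ind x + 0 ≡ ind (x ∧ not t) + ind (x ∧ t)
  split true  true  = refl
  split true  false = refl
  split false t     = refl

≟-fsuc : ∀ {k} (i j : Fin k) → ⌊ fsuc j ≟ fsuc i ⌋ ≡ ⌊ j ≟ i ⌋
≟-fsuc i j with j ≟ i
... | yes _ = refl
... | no _  = refl

count-at : ∀ {n} (i : Fin n) (h : Fin n → Bool) → count (λ j → ⌊ j ≟ i ⌋ ∧ h j) ≡ ind (h i)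
count-at {suc n} fzero    h = trans (count-suc (λ j → ⌊ j ≟ fzero ⌋ ∧ h j))
  (trans (cong (ind (h fzero) +_) (count-false {n})) (+-identityʳ _))
count-at {suc n} (fsuc i) h = trans (count-suc (λ j → ⌊ j ≟ fsuc i ⌋ ∧ h j))
  (trans (count-cong (λ j → cong (_∧ h (fsuc j)) (≟-fsuc i j))) (count-at i (h ∘ fsuc)))

count-zipWith : ∀ {n} (op : Bool → Bool → Bool) (a b : Fin n → Bool) →
  ∣ zipWith op (tabulate a) (tabulate b) ∣ ≡ count (λ v → op (a v) (b v))
count-zipWith op a b = cong ∣_∣ (zipWith-tabulate a b)
  where
  zipWith-tabulate : ∀ {m} (a b : Fin m → Bool) →
    zipWith op (tabulate a) (tabulate b) ≡ tabulate (λ v → op (a v) (b v))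
  zipWith-tabulate {0}     a b = refl
  zipWith-tabulate {suc m} a b = cong (op (a fzero) (b fzero) ∷_) (zipWith-tabulate (a ∘ fsuc) (b ∘ fsuc))

≟-sound : ∀ {k} {i j : Fin k} → ⌊ j ≟ i ⌋ ≡ true → j ≡ i
≟-sound {i = i} {j} eq with j ≟ i
... | yes j≡i = j≡i

cost-count : ∀ {n k k'} (f : Fin n → Fin k) (g : Fin n → Fin k') S S' →
  cost f g S S' ≡ count (λ v → lookup S (f v) xor lookup S' (g v))
cost-count f g S S' = count-zipWith _xor_ (λ v → lookup S (f v)) (λ v → lookup S' (g v))

cost-sym : ∀ {n k k'} (f : Fin n → Fin k) (g : Fin n → Fin k') S S' →
  cost f g S S' ≡ cost g f S' S
cost-sym f g S S' = trans (cost-count f g S S')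
  (trans (count-cong (λ v → xor-comm (lookup S (f v)) _)) (sym (cost-count g f S' S)))

toggle : ∀ {k} → Subset k → Fin k → Subset k
toggle S i = tabulate (λ j → lookup S j xor ⌊ j ≟ i ⌋)

toggle-size : ∀ {k} (S : Subset k) (i : Fin k) →
  ∣ toggle S i ∣ + ind (lookup S i) ≡ ∣ S ∣ + ind (not (lookup S i))
toggle-size S i = begin
  ∣ toggle S i ∣ + ind (s i)
    ≡⟨ cong (∣ toggle S i ∣ +_) (sym (count-at i s)) ⟩
  count (λ j → s j xor δ j) + count (λ j → δ j ∧ s j)
    ≡⟨ count-additive _ _ _ _ (λ j → pointwise (s j) (δ j)) ⟩
  count s + count (λ j → δ j ∧ not (s j))
    ≡⟨ cong₂ _+_ (cong ∣_∣ (tabulate∘lookup S)) (count-at i (not ∘ s)) ⟩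
  ∣ S ∣ + ind (not (s i)) ∎
  where
  open ≡-Reasoning
  s = lookup S
  δ = λ j → ⌊ j ≟ i ⌋
  pointwise : ∀ x e → ind (x xor e) + ind (e ∧ x) ≡ ind x + ind (e ∧ not x)
  pointwise true  true  = refl
  pointwise false true  = refl
  pointwise x     false = cong (λ b → ind b + 0) (xor-comm x false)

toggle-isCP : ∀ {k} (S : Subset k) (i : Fin k) → ∣ S ∣ ≢ 1 → ∣ S ∣ + 1 ≢ k → IsCP (toggle S i)
toggle-isCP {k} S i |S|≢1 |S|+1≢k with lookup S i | toggle-size S i
... | true  | size = T≢⊥ , T≢⊤
  where
  T≢⊥ : toggle S i ≢ ⊥
  T≢⊥ T≡⊥ = |S|≢1 (begin
    ∣ S ∣                   ≡⟨ sym (+-identityʳ _) ⟩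
    ∣ S ∣ + 0               ≡⟨ sym size ⟩
    ∣ toggle S i ∣ + 1      ≡⟨ cong (λ T → ∣ T ∣ + 1) T≡⊥ ⟩
    ∣ ⊥ {k} ∣ + 1           ≡⟨ cong (_+ 1) (∣⊥∣≡0 k) ⟩
    1 ∎)
    where open ≡-Reasoning
  T≢⊤ : toggle S i ≢ ⊤
  T≢⊤ T≡⊤ = m+1+n≰m k (≤-trans (≤-reflexive k+1≡|S|) (∣p∣≤n S))
    where
    k+1≡|S| : k + 1 ≡ ∣ S ∣
    k+1≡|S| = begin
      k + 1                ≡⟨ cong (_+ 1) (sym (∣⊤∣≡n k)) ⟩
      ∣ ⊤ {k} ∣ + 1        ≡⟨ cong (λ T → ∣ T ∣ + 1) (sym T≡⊤) ⟩
      ∣ toggle S i ∣ + 1   ≡⟨ size ⟩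
      ∣ S ∣ + 0            ≡⟨ +-identityʳ _ ⟩
      ∣ S ∣ ∎
      where open ≡-Reasoning
... | false | size = T≢⊥ , T≢⊤
  where
  T≢⊥ : toggle S i ≢ ⊥
  T≢⊥ T≡⊥ = 0≢1+n (begin
    0                    ≡⟨ cong (_+ 0) (sym (∣⊥∣≡0 k)) ⟩
    ∣ ⊥ {k} ∣ + 0        ≡⟨ cong (λ T → ∣ T ∣ + 0) (sym T≡⊥) ⟩
    ∣ toggle S i ∣ + 0   ≡⟨ size ⟩
    ∣ S ∣ + 1            ≡⟨ +-comm ∣ S ∣ 1 ⟩
    suc ∣ S ∣ ∎)
    where open ≡-Reasoning
  T≢⊤ : toggle S i ≢ ⊤
  T≢⊤ T≡⊤ = |S|+1≢k (begin
    ∣ S ∣ + 1            ≡⟨ sym size ⟩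
    ∣ toggle S i ∣ + 0   ≡⟨ cong (λ T → ∣ T ∣ + 0) T≡⊤ ⟩
    ∣ ⊤ {k} ∣ + 0        ≡⟨ cong (_+ 0) (∣⊤∣≡n k) ⟩
    k + 0                ≡⟨ +-identityʳ k ⟩
    k ∎)
    where open ≡-Reasoning

-- Given a membership bit s for the label i, the elements of the part P_i whose
-- membership in U_𝒮' agrees, resp. disagrees, with s.
agreeing : ∀ {n k k'} (f : Fin n → Fin k) (g : Fin n → Fin k') → Subset k' → Fin k → Bool → ℕ
agreeing f g S' i s = count (λ v → ⌊ f v ≟ i ⌋ ∧ not (s xor lookup S' (g v)))

disagreeing : ∀ {n k k'} (f : Fin n → Fin k) (g : Fin n → Fin k') → Subset k' → Fin k → Bool → ℕ
disagreeing f g S' i s = count (λ v → ⌊ f v ≟ i ⌋ ∧ (s xor lookup S' (g v)))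

part-size : ∀ {n k k'} (f : Fin n → Fin k) (g : Fin n → Fin k') S' i s →
  ∣ part f i ∣ ≡ agreeing f g S' i s + disagreeing f g S' i s
part-size f g S' i s = count-split (λ v → ⌊ f v ≟ i ⌋) (λ v → s xor lookup S' (g v))

agreeing-inside : ∀ {n k k'} (f : Fin n → Fin k) (g : Fin n → Fin k') S' i →
  agreeing f g S' i true ≡ ∣ part f i ∩ U g S' ∣
agreeing-inside f g S' i = trans
  (count-cong (λ v → cong (⌊ f v ≟ i ⌋ ∧_) (not-involutive (lookup S' (g v)))))
  (sym (count-zipWith _∧_ (λ v → ⌊ f v ≟ i ⌋) (λ v → lookup S' (g v))))

disagreeing-outside : ∀ {n k k'} (f : Fin n → Fin k) (g : Fin n → Fin k') S' i →
  disagreeing f g S' i false ≡ ∣ part f i ∩ U g S' ∣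
disagreeing-outside f g S' i = sym (count-zipWith _∧_ (λ v → ⌊ f v ≟ i ⌋) (λ v → lookup S' (g v)))

-- The pointwise form of the exchange identity, for a point with membership x,
-- with d telling whether it lies in P_i and t whether it lies in U_𝒮'.
exchange-pointwise : ∀ x s t d → (d ≡ true → x ≡ s) →
  ind (x xor t) + ind (d ∧ not (s xor t)) ≡ ind ((x xor d) xor t) + ind (d ∧ (s xor t))
exchange-pointwise x s t false _ = cong (λ y → ind (y xor t) + 0) (sym (xor-comm x false))
exchange-pointwise x s t true x≡s with x≡s refl
... | refl = complementary x t
  where
  complementary : ∀ s t → ind (s xor t) + ind (not (s xor t)) ≡ ind ((s xor true) xor t) + ind (s xor t)
  complementary true  true  = refl
  complementary true  false = refl
  complementary false true  = refl
  complementary false false = refl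

exchange : ∀ {n k k'} (f : Fin n → Fin k) (g : Fin n → Fin k') S S' i →
  cost f g S S' + agreeing f g S' i (lookup S i) ≡ cost f g (toggle S i) S' + disagreeing f g S' i (lookup S i)
exchange f g S S' i = begin
  cost f g S S' + agreeing f g S' i s
    ≡⟨ cong (_+ agreeing f g S' i s) (cost-count f g S S') ⟩
  count (λ v → lookup S (f v) xor σ v) + agreeing f g S' i s
    ≡⟨ count-additive _ _ _ _ pointwise ⟩
  count (λ v → lookup (toggle S i) (f v) xor σ v) + disagreeing f g S' i s
    ≡⟨ cong (_+ disagreeing f g S' i s) (sym (cost-count f g (toggle S i) S')) ⟩
  cost f g (toggle S i) S' + disagreeing f g S' i s ∎
  where
  open ≡-Reasoning
  s = lookup S i
  σ = λ v → lookup S' (g v)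
  pointwise : ∀ v → ind (lookup S (f v) xor σ v) + ind (⌊ f v ≟ i ⌋ ∧ not (s xor σ v))
                  ≡ ind (lookup (toggle S i) (f v) xor σ v) + ind (⌊ f v ≟ i ⌋ ∧ (s xor σ v))
  pointwise v rewrite lookup∘tabulate (λ j → lookup S j xor ⌊ j ≟ i ⌋) (f v) =
    exchange-pointwise (lookup S (f v)) s (σ v) ⌊ f v ≟ i ⌋ (cong (lookup S) ∘ ≟-sound)

Balanced : ∀ {n k k'} → (Fin n → Fin k) → (Fin n → Fin k') → Subset k → Subset k' → Set
Balanced {k = k} f g S S' =
  (∀ (i : Fin k) → i ∈ S → ∣ part f i ∣ ≤ 2 * ∣ part f i ∩ U g S' ∣) ×
  (∀ (i : Fin k) → i ∉ S → 2 * ∣ part f i ∩ U g S' ∣ ≤ ∣ part f i ∣)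

mutual-if-balanced : ∀ {n k k'} (f : Fin n → Fin k) (g : Fin n → Fin k') S S' →
  Balanced f g S S' → Balanced g f S' S → Mutual f g S S'
mutual-if-balanced f g S S' (inside , outside) (inside' , outside') = inside , outside , inside' , outside'

disagreeing≤agreeing : ∀ {n k k'} (f : Fin n → Fin k) (g : Fin n → Fin k') S S' i →
  cost f g S S' ≤ cost f g (toggle S i) S' →
  disagreeing f g S' i (lookup S i) ≤ agreeing f g S' i (lookup S i)
disagreeing≤agreeing f g S S' i no-gain = +-cancelˡ-≤ (cost f g (toggle S i) S') D A (begin
  cost f g (toggle S i) S' + D   ≡⟨ sym (exchange f g S S' i) ⟩
  cost f g S S' + A              ≤⟨ +-monoˡ-≤ A no-gain ⟩
  cost f g (toggle S i) S' + A   ∎)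
  where
  open ≤-Reasoning
  A = agreeing f g S' i (lookup S i)
  D = disagreeing f g S' i (lookup S i)

balanced-if-locally-optimal : ∀ {n k k'} (f : Fin n → Fin k) (g : Fin n → Fin k') S S' →
  (∀ i → cost f g S S' ≤ cost f g (toggle S i) S') → Balanced f g S S'
balanced-if-locally-optimal f g S S' no-gain = inside , outside
  where
  open ≤-Reasoning
  D≤A : ∀ i {s} → lookup S i ≡ s → disagreeing f g S' i s ≤ agreeing f g S' i s
  D≤A i refl = disagreeing≤agreeing f g S S' i (no-gain i)
  inside : ∀ i → i ∈ S → ∣ part f i ∣ ≤ 2 * ∣ part f i ∩ U g S' ∣
  inside i i∈S = begin
    ∣ part f i ∣   ≡⟨ part-size f g S' i true ⟩
    A + D          ≤⟨ +-monoʳ-≤ A (D≤A i ([]=⇒lookup i∈S)) ⟩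
    A + A          ≡⟨ cong (A +_) (sym (+-identityʳ A)) ⟩
    2 * A          ≡⟨ cong (2 *_) (agreeing-inside f g S' i) ⟩
    2 * ∣ part f i ∩ U g S' ∣ ∎
    where
    A = agreeing f g S' i true
    D = disagreeing f g S' i true
  outside : ∀ i → i ∉ S → 2 * ∣ part f i ∩ U g S' ∣ ≤ ∣ part f i ∣
  outside i i∉S = begin
    2 * ∣ part f i ∩ U g S' ∣ ≡⟨ cong (2 *_) (sym (disagreeing-outside f g S' i)) ⟩
    2 * D          ≡⟨ cong (D +_) (+-identityʳ D) ⟩
    D + D          ≤⟨ +-monoˡ-≤ D (D≤A i (¬-not (i∉S ∘ lookup⇒[]= i S))) ⟩
    A + D          ≡⟨ sym (part-size f g S' i false) ⟩
    ∣ part f i ∣   ∎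
    where
    A = agreeing f g S' i false
    D = disagreeing f g S' i false

-- Toggles of 𝒮' are always admissible, and toggles of 𝒮 are admissible when
-- |𝒮| ∉ {1, |𝒫| − 1}; so in that case optimality makes both sides balanced.
proposition11 : (n k k' : ℕ) (f : Fin n → Fin k) (g : Fin n → Fin k') →
    IsPartition f → IsPartition g → 2 ≤ k →
    (S : Subset k) (S' : Subset k') → Optimal f g S S' →
    ¬ Mutual f g S S' →
    (∣ S ∣ ≡ 1 ⊎ ∣ S ∣ + 1 ≡ k) ⊎ (∣ S' ∣ ≡ 1 ⊎ ∣ S' ∣ + 1 ≡ k')
proposition11 n k k' f g _ _ _ S S' (S-isCP , optimal) ¬mutual
  with ∣ S ∣ ≟ℕ 1 | ∣ S ∣ + 1 ≟ℕ k
... | yes |S|≡1 | _           = inj₁ (inj₁ |S|≡1)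
... | no _      | yes |S|+1≡k = inj₁ (inj₂ |S|+1≡k)
... | no |S|≢1  | no |S|+1≢k  =
  contradiction (mutual-if-balanced f g S S' balanced-S balanced-S') ¬mutual
  where
  balanced-S : Balanced f g S S'
  balanced-S = balanced-if-locally-optimal f g S S'
    (λ i → optimal (toggle S i) S' (toggle-isCP S i |S|≢1 |S|+1≢k))
  balanced-S' : Balanced g f S' S
  balanced-S' = balanced-if-locally-optimal g f S' S
    (λ j → subst₂ _≤_ (cost-sym f g S S') (cost-sym f g S (toggle S' j)) (optimal S (toggle S' j) S-isCP))
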